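{- Let $G$ be a hypergraph and $(A,\overline A)$ a separation of $G$ such that both $A$ and $\overline A$ are tri-well-linked. Then $G$ has a tangle $\mathscr{T}$ of order $\lambda(A)$ such that every $B\subseteq E(G)$ with $\lambda(B)<\lambda(A)$ and with $B\subseteq A$ or $B\subseteq\overline A$ belongs to $\mathscr{T}$.
   Context: A hypergraph $G$ consists of finite sets $V(G)$, $E(G)$ and for each hyperedge $e$ a set $V(e)\subseteq V(G)$ (distinct hyperedges may share vertex sets), every vertex lying in some $V(e)$. For $X\subseteq E(G)$: $V(X)=\bigcup_{e\in X}V(e)$, $\overline X=E(G)\setminus X$, $\lambda(X)=|V(X)\cap V(\overline X)|$. A separation is a pair $(X,\overline X)$. $X$ is tri-well-linked if for every triple $(B_1,B_2,B_3)$ of pairwise disjoint, possibly empty, sets with union $X$, some $i$ has $\lambda(B_i)\ge\lambda(X)$. A tangle of order $k'$ is a family $\mathscr{T}$ of subsets of $E(G)$ with: (1) $\lambda(X)<k'$ for all $X\in\mathscr{T}$; (2) for every $X$ with $\lambda(X)<k'$, $X\in\mathscr{T}$ or $\overline X\in\mathscr{T}$; (3) no $X,Y,Z\in\mathscr{T}$ with $X\cup Y\cup Z=E(G)$; (4) $E(G)\setminus\{e\}\notin\mathscr{T}$ for all $e\in E(G)$. -}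

module Defs where

open import Data.Nat using (ℕ; _<_; _≥_)
open import Data.Bool using (Bool; true; false; _∧_; _∨_)
open import Data.Fin using (Fin; zero; suc)
open import Data.Fin.Subset using (Subset; _∈_; _⊆_; ∁; _∩_; _∪_; ⊥; ⊤; ⁅_⁆; ∣_∣)
open import Data.Vec using (tabulate; lookup)
open import Data.Product using (Σ; ∃; _×_)
open import Data.Sum using (_⊎_)
open import Relation.Nullary using (¬_)
open import Relation.Binary.PropositionalEquality using (_≡_; _≢_)

anyFin : ∀ {m} → (Fin m → Bool) → Bool
anyFin {ℕ.zero} f = false
anyFin {ℕ.suc m} f = f zero ∨ anyFin (λ i → f (suc i))

record Hypergraph : Set where
  field
    nV : ℕ
    nE : ℕ
    inc : Fin nE → Subset nV
    covers : ∀ (v : Fin nV) → ∃ λ (e : Fin nE) → v ∈ inc e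

module _ (G : Hypergraph) where
  open Hypergraph G

  VOf : Subset nE → Subset nV
  VOf X = tabulate (λ v → anyFin (λ e → lookup X e ∧ lookup (inc e) v))

  conn : Subset nE → ℕ
  conn X = ∣ VOf X ∩ VOf (∁ X) ∣

  TriWellLinked : Subset nE → Set
  TriWellLinked X =
    ∀ (B₁ B₂ B₃ : Subset nE) →
      B₁ ∩ B₂ ≡ ⊥ → B₁ ∩ B₃ ≡ ⊥ → B₂ ∩ B₃ ≡ ⊥ →
      B₁ ∪ (B₂ ∪ B₃) ≡ X →
      (conn B₁ ≥ conn X) ⊎ (conn B₂ ≥ conn X) ⊎ (conn B₃ ≥ conn X)

  IsTangle : ℕ → (Subset nE → Set) → Set
  IsTangle k 𝒯 =
    (∀ X → 𝒯 X → conn X < k) ×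
    (∀ X → conn X < k → 𝒯 X ⊎ 𝒯 (∁ X)) ×
    (∀ X Y Z → 𝒯 X → 𝒯 Y → 𝒯 Z → X ∪ (Y ∪ Z) ≢ ⊤) ×
    (∀ e → ¬ 𝒯 (∁ ⁅ e ⁆))

-- Let k = λ(A) and let 𝒯 consist of the X with λ(X), λ(X ∩ A) and λ(X ∖ A) all below k.
-- Neither A nor its complement splits into two parts of connectivity < k; combined with
-- submodularity and posimodularity of λ this puts X or its complement into 𝒯. Three members
-- of 𝒯 covering E(G) would cut A into three parts of connectivity < k; uncrossing them
-- pairwise (replacing X by X ∖ Y, or else Y by Y ∖ X, which by posimodularity keeps both
-- below k) makes the parts disjoint, contradicting the tri-well-linkedness of A.
module Submission where

open import Defs
open import Data.Nat using (_<_)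
open import Data.Fin.Subset using (Subset; _⊆_; ∁)
open import Data.Product using (Σ; _×_)
open import Data.Sum using (_⊎_)

open import Algebra.Bundles using (CommutativeMonoid)
open import Data.Bool using (Bool; true; false; _∧_; _∨_)
open import Data.Bool.Properties using (∨-zeroʳ)
open import Data.Empty using (⊥; ⊥-elim)
open import Data.Fin using (Fin; zero; suc)
open import Data.Fin.Subset
  using (_∈_; _∉_; _∩_; _∪_; _─_; ⁅_⁆; ∣_∣; Nonempty; inside; outside)
  renaming (⊥ to ∅; ⊤ to full)
open import Data.Fin.Subset.Properties
open import Data.Nat using (ℕ; suc; _+_; _≤_; _≥_; _≤?_; z≤n)
open import Data.Nat.Induction using (<-wellFounded)
open import Data.Nat.Properties
  using (+-suc; +-comm; +-mono-≤; +-monoˡ-<; +-monoʳ-<; +-cancelˡ-<; ≤-trans; ≤-<-trans;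
         <-≤-trans; <-trans; <⇒≱; ≰⇒>; n≮n; module ≤-Reasoning)
open import Data.Product using (_,_; proj₁; proj₂; ∃)
import Data.Product as Product
open import Data.Sum using (inj₁; inj₂)
import Data.Sum as Sum
open import Data.Vec using (_∷_; [])
open import Data.Vec.Properties using (lookup∘tabulate; lookup⇒[]=; []=⇒lookup)
open import Function using (id)
open import Induction.WellFounded using (Acc; acc)
open import Relation.Nullary using (¬_; yes; no)
open import Relation.Binary.PropositionalEquality
  using (_≡_; _≢_; refl; sym; trans; cong; cong₂; subst; module ≡-Reasoning)

import Algebra.Lattice.Properties.BooleanAlgebra as BooleanAlgebraProperties
import Algebra.Properties.CommutativeSemigroup as CommutativeSemigroupProperties

∣p∩q∣+∣p∪q∣≡∣p∣+∣q∣ : ∀ {n} (p q : Subset n) → ∣ p ∩ q ∣ + ∣ p ∪ q ∣ ≡ ∣ p ∣ + ∣ q ∣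
∣p∩q∣+∣p∪q∣≡∣p∣+∣q∣ [] [] = refl
∣p∩q∣+∣p∪q∣≡∣p∣+∣q∣ (outside ∷ p) (outside ∷ q) = ∣p∩q∣+∣p∪q∣≡∣p∣+∣q∣ p q
∣p∩q∣+∣p∪q∣≡∣p∣+∣q∣ (inside ∷ p) (outside ∷ q) =
  trans (+-suc ∣ p ∩ q ∣ _) (cong suc (∣p∩q∣+∣p∪q∣≡∣p∣+∣q∣ p q))
∣p∩q∣+∣p∪q∣≡∣p∣+∣q∣ (outside ∷ p) (inside ∷ q) =
  trans (+-suc ∣ p ∩ q ∣ _) (trans (cong suc (∣p∩q∣+∣p∪q∣≡∣p∣+∣q∣ p q)) (sym (+-suc ∣ p ∣ _)))
∣p∩q∣+∣p∪q∣≡∣p∣+∣q∣ (inside ∷ p) (inside ∷ q) =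
  cong suc (trans (+-suc ∣ p ∩ q ∣ _)
    (trans (cong suc (∣p∩q∣+∣p∪q∣≡∣p∣+∣q∣ p q)) (sym (+-suc ∣ p ∣ _))))

∣p∣+∣q∣≤∣r∣+∣s∣ : ∀ {n} {p q r s : Subset n} →
  p ∪ q ⊆ r ∪ s → p ∩ q ⊆ r ∩ s → ∣ p ∣ + ∣ q ∣ ≤ ∣ r ∣ + ∣ s ∣
∣p∣+∣q∣≤∣r∣+∣s∣ {p = p} {q} {r} {s} ∪⊆ ∩⊆ = begin
  ∣ p ∣ + ∣ q ∣             ≡⟨ ∣p∩q∣+∣p∪q∣≡∣p∣+∣q∣ p q ⟨
  ∣ p ∩ q ∣ + ∣ p ∪ q ∣     ≤⟨ +-mono-≤ (p⊆q⇒∣p∣≤∣q∣ ∩⊆) (p⊆q⇒∣p∣≤∣q∣ ∪⊆) ⟩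
  ∣ r ∩ s ∣ + ∣ r ∪ s ∣     ≡⟨ ∣p∩q∣+∣p∪q∣≡∣p∣+∣q∣ r s ⟩
  ∣ r ∣ + ∣ s ∣             ∎
  where open ≤-Reasoning

p⊆q⇒p∩q≡p : ∀ {n} {p q : Subset n} → p ⊆ q → p ∩ q ≡ p
p⊆q⇒p∩q≡p {p = p} {q} p⊆q = ⊆-antisym (p∩q⊆p p q) (λ x∈p → x∈p∩q⁺ (x∈p , p⊆q x∈p))

disjoint-mono : ∀ {n} {p p′ q q′ : Subset n} → p ⊆ p′ → q ⊆ q′ → p′ ∩ q′ ≡ ∅ → p ∩ q ≡ ∅
disjoint-mono {p = p} {q = q} p⊆p′ q⊆q′ p′∩q′≡∅ = Empty-unique λ (x , x∈p∩q) →
  let x∈p , x∈q = x∈p∩q⁻ p q x∈p∩q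
  in ∉⊥ (subst (x ∈_) p′∩q′≡∅ (x∈p∩q⁺ (p⊆p′ x∈p , q⊆q′ x∈q)))

x∉p⇒p⊆∁⁅x⁆ : ∀ {n} {x : Fin n} {p : Subset n} → x ∉ p → p ⊆ ∁ ⁅ x ⁆
x∉p⇒p⊆∁⁅x⁆ {x = x} {p} x∉p y∈p =
  x∉p⇒x∈∁p λ y∈⁅x⁆ → x∉p (subst (_∈ p) (x∈⁅y⁆⇒x≡y x y∈⁅x⁆) y∈p)

─≡∩∁ : ∀ {n} (p q : Subset n) → p ─ q ≡ p ∩ ∁ q
─≡∩∁ [] [] = refl
─≡∩∁ (inside ∷ p) (outside ∷ q) = cong (inside ∷_) (─≡∩∁ p q)
─≡∩∁ (outside ∷ p) (outside ∷ q) = cong (outside ∷_) (─≡∩∁ p q)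
─≡∩∁ (inside ∷ p) (inside ∷ q) = cong (outside ∷_) (─≡∩∁ p q)
─≡∩∁ (outside ∷ p) (inside ∷ q) = cong (outside ∷_) (─≡∩∁ p q)

[p─q]∪q≡p∪q : ∀ {n} (p q : Subset n) → (p ─ q) ∪ q ≡ p ∪ q
[p─q]∪q≡p∪q p q = begin
  (p ─ q) ∪ q             ≡⟨ cong (_∪ q) (─≡∩∁ p q) ⟩
  (p ∩ ∁ q) ∪ q           ≡⟨ ∪-distribʳ-∩ q p (∁ q) ⟩
  (p ∪ q) ∩ (∁ q ∪ q)     ≡⟨ cong ((p ∪ q) ∩_) (∪-inverseˡ q) ⟩
  (p ∪ q) ∩ full          ≡⟨ ∩-identityʳ (p ∪ q) ⟩
  p ∪ q                   ∎
  where open ≡-Reasoning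

anyFin-true⁺ : ∀ {m} (f : Fin m → Bool) i → f i ≡ true → anyFin f ≡ true
anyFin-true⁺ f zero fi = cong (_∨ anyFin (λ j → f (suc j))) fi
anyFin-true⁺ f (suc i) fi =
  trans (cong (f zero ∨_) (anyFin-true⁺ (λ j → f (suc j)) i fi)) (∨-zeroʳ (f zero))

anyFin-true⁻ : ∀ {m} (f : Fin m → Bool) → anyFin f ≡ true → ∃ λ i → f i ≡ true
anyFin-true⁻ {suc m} f any-f with f zero in f0
... | true = zero , f0
... | false = Product.map suc id (anyFin-true⁻ (λ j → f (suc j)) any-f)

∧≡true⁻ : ∀ {a b} → a ∧ b ≡ true → a ≡ true × b ≡ true
∧≡true⁻ {true} {true} _ = refl , refl

+-≤-<⇒< : ∀ {a b c d} → a + b ≤ c + d → c < a → b < d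
+-≤-<⇒< {b = b} {c} {d} a+b≤c+d c<a = +-cancelˡ-< c b d (<-≤-trans (+-monoˡ-< b c<a) a+b≤c+d)

large⇒smallʳ : ∀ {a b c k} → c < k → a + b ≤ c + k → k ≤ a → b < k
large⇒smallʳ {k = k} c<k a+b≤c+k k≤a =
  ≰⇒> λ k≤b → <⇒≱ (+-monoˡ-< k c<k) (≤-trans (+-mono-≤ k≤a k≤b) a+b≤c+k)

large⇒smallˡ : ∀ {a b c k} → c < k → a + b ≤ c + k → k ≤ b → a < k
large⇒smallˡ {a} {b} {c} {k} c<k a+b≤c+k = large⇒smallʳ c<k (subst (_≤ c + k) (+-comm a b) a+b≤c+k)

module _ (G : Hypergraph) where
  open Hypergraph G
  open BooleanAlgebraProperties (∪-∩-booleanAlgebra nE) using (deMorgan₁; deMorgan₂; ¬-involutive)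
  open CommutativeSemigroupProperties
    (CommutativeMonoid.commutativeSemigroup (∪-commutativeMonoid nE)) using (x∙yz≈y∙xz)

  ∈VOf⁺ : ∀ {X e v} → e ∈ X → v ∈ inc e → v ∈ VOf G X
  ∈VOf⁺ {X} {e} {v} e∈X v∈e = lookup⇒[]= v _ (trans (lookup∘tabulate _ v)
    (anyFin-true⁺ _ e (cong₂ _∧_ ([]=⇒lookup e∈X) ([]=⇒lookup v∈e))))

  ∈VOf⁻ : ∀ X {v} → v ∈ VOf G X → ∃ λ e → e ∈ X × v ∈ inc e
  ∈VOf⁻ X {v} v∈VX
    with e , X∧e ← anyFin-true⁻ _ (trans (sym (lookup∘tabulate _ v)) ([]=⇒lookup v∈VX))
    with e∈X , v∈e ← ∧≡true⁻ X∧e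
    = e , lookup⇒[]= e X e∈X , lookup⇒[]= v (inc e) v∈e

  VOf-mono : ∀ {X Y} → X ⊆ Y → VOf G X ⊆ VOf G Y
  VOf-mono X⊆Y v∈VX with e , e∈X , v∈e ← ∈VOf⁻ _ v∈VX = ∈VOf⁺ (X⊆Y e∈X) v∈e

  VOf-∪ : ∀ X Y → VOf G (X ∪ Y) ⊆ VOf G X ∪ VOf G Y
  VOf-∪ X Y v∈V with e , e∈X∪Y , v∈e ← ∈VOf⁻ (X ∪ Y) v∈V with x∈p∪q⁻ X Y e∈X∪Y
  ... | inj₁ e∈X = x∈p∪q⁺ (inj₁ (∈VOf⁺ e∈X v∈e))
  ... | inj₂ e∈Y = x∈p∪q⁺ (inj₂ (∈VOf⁺ e∈Y v∈e))

  VOf-∅ : VOf G ∅ ≡ ∅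
  VOf-∅ = Empty-unique λ (v , v∈V∅) → ∉⊥ (proj₁ (proj₂ (∈VOf⁻ ∅ v∈V∅)))

  boundary : Subset nE → Subset nV
  boundary X = VOf G X ∩ VOf G (∁ X)

  conn-∅ : conn G ∅ ≡ 0
  conn-∅ = begin
    ∣ VOf G ∅ ∩ VOf G (∁ ∅) ∣   ≡⟨ cong (λ V → ∣ V ∩ VOf G (∁ ∅) ∣) VOf-∅ ⟩
    ∣ ∅ ∩ VOf G (∁ ∅) ∣         ≡⟨ cong ∣_∣ (∩-zeroˡ (VOf G (∁ ∅))) ⟩
    ∣ ∅ {nV} ∣                  ≡⟨ ∣⊥∣≡0 nV ⟩
    0                           ∎
    where open ≡-Reasoning

  conn-∁ : ∀ X → conn G (∁ X) ≡ conn G X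
  conn-∁ X = trans (cong (λ Y → ∣ VOf G (∁ X) ∩ VOf G Y ∣) (¬-involutive X))
                   (cong ∣_∣ (∩-comm (VOf G (∁ X)) (VOf G X)))

  boundary-∩ : ∀ X Y {v} → v ∈ boundary (X ∩ Y) →
    v ∈ VOf G X × v ∈ VOf G Y × (v ∈ VOf G (∁ X) ⊎ v ∈ VOf G (∁ Y))
  boundary-∩ X Y v∈∂ =
    let v∈V , v∈V∁ = x∈p∩q⁻ _ _ v∈∂
    in VOf-mono (p∩q⊆p X Y) v∈V , VOf-mono (p∩q⊆q X Y) v∈V ,
       x∈p∪q⁻ _ _ (VOf-∪ (∁ X) (∁ Y) (VOf-mono (⊆-reflexive (deMorgan₁ X Y)) v∈V∁))

  boundary-∪ : ∀ X Y {v} → v ∈ boundary (X ∪ Y) →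
    (v ∈ VOf G X ⊎ v ∈ VOf G Y) × v ∈ VOf G (∁ X) × v ∈ VOf G (∁ Y)
  boundary-∪ X Y v∈∂ =
    let v∈V , v∈V∁ = x∈p∩q⁻ _ _ v∈∂
    in x∈p∪q⁻ _ _ (VOf-∪ X Y v∈V) ,
       VOf-mono (p⊆q⇒∁p⊇∁q (p⊆p∪q {p = X} Y)) v∈V∁ , VOf-mono (p⊆q⇒∁p⊇∁q (q⊆p∪q X Y)) v∈V∁

  conn-submodular : ∀ X Y → conn G (X ∩ Y) + conn G (X ∪ Y) ≤ conn G X + conn G Y
  conn-submodular X Y = ∣p∣+∣q∣≤∣r∣+∣s∣ ∪⊆ ∩⊆
    where
    ∈∂ : ∀ Z {v} → v ∈ VOf G Z → v ∈ VOf G (∁ Z) → v ∈ boundary Z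
    ∈∂ _ v∈V v∈V∁ = x∈p∩q⁺ (v∈V , v∈V∁)

    ∪⊆ : boundary (X ∩ Y) ∪ boundary (X ∪ Y) ⊆ boundary X ∪ boundary Y
    ∪⊆ v∈ with x∈p∪q⁻ _ _ v∈
    ... | inj₁ v∈∂∩ with boundary-∩ X Y v∈∂∩
    ...   | v∈VX , v∈VY , inj₁ v∈V∁X = x∈p∪q⁺ (inj₁ (∈∂ X v∈VX v∈V∁X))
    ...   | v∈VX , v∈VY , inj₂ v∈V∁Y = x∈p∪q⁺ (inj₂ (∈∂ Y v∈VY v∈V∁Y))
    ∪⊆ v∈ | inj₂ v∈∂∪ with boundary-∪ X Y v∈∂∪
    ...   | inj₁ v∈VX , v∈V∁X , v∈V∁Y = x∈p∪q⁺ (inj₁ (∈∂ X v∈VX v∈V∁X))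
    ...   | inj₂ v∈VY , v∈V∁X , v∈V∁Y = x∈p∪q⁺ (inj₂ (∈∂ Y v∈VY v∈V∁Y))

    ∩⊆ : boundary (X ∩ Y) ∩ boundary (X ∪ Y) ⊆ boundary X ∩ boundary Y
    ∩⊆ v∈ =
      let v∈∂∩ , v∈∂∪ = x∈p∩q⁻ _ _ v∈
          v∈VX , v∈VY , _ = boundary-∩ X Y v∈∂∩
          _ , v∈V∁X , v∈V∁Y = boundary-∪ X Y v∈∂∪
      in x∈p∩q⁺ (∈∂ X v∈VX v∈V∁X , ∈∂ Y v∈VY v∈V∁Y)

  conn-∩-∁∩ : ∀ X Y → conn G (X ∩ Y) + conn G (∁ X ∩ ∁ Y) ≤ conn G X + conn G Y
  conn-∩-∁∩ X Y = begin
    conn G (X ∩ Y) + conn G (∁ X ∩ ∁ Y)   ≡⟨ cong (λ Z → conn G (X ∩ Y) + conn G Z) (deMorgan₂ X Y) ⟨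
    conn G (X ∩ Y) + conn G (∁ (X ∪ Y))   ≡⟨ cong (conn G (X ∩ Y) +_) (conn-∁ (X ∪ Y)) ⟩
    conn G (X ∩ Y) + conn G (X ∪ Y)       ≤⟨ conn-submodular X Y ⟩
    conn G X + conn G Y                   ∎
    where open ≤-Reasoning

  conn-posimodular : ∀ X Y → conn G (X ∩ ∁ Y) + conn G (∁ X ∩ Y) ≤ conn G X + conn G Y
  conn-posimodular X Y = begin
    conn G (X ∩ ∁ Y) + conn G (∁ X ∩ Y)       ≡⟨ cong (λ Z → conn G (X ∩ ∁ Y) + conn G (∁ X ∩ Z)) (¬-involutive Y) ⟨
    conn G (X ∩ ∁ Y) + conn G (∁ X ∩ ∁ (∁ Y)) ≤⟨ conn-∩-∁∩ X (∁ Y) ⟩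
    conn G X + conn G (∁ Y)                   ≡⟨ cong (conn G X +_) (conn-∁ Y) ⟩
    conn G X + conn G Y                       ∎
    where open ≤-Reasoning

  conn-─-trade : ∀ X Y → conn G X < conn G (X ─ Y) → conn G (Y ─ X) < conn G Y
  conn-─-trade X Y grows = +-≤-<⇒< posimodular grows
    where
    posimodular : conn G (X ─ Y) + conn G (Y ─ X) ≤ conn G X + conn G Y
    posimodular rewrite ─≡∩∁ X Y | ─≡∩∁ Y X | ∩-comm Y (∁ X) = conn-posimodular X Y

  record Uncrossing (k : ℕ) (X Y : Subset nE) : Set where
    field
      X′ Y′ : Subset nE
      X′⊆X : X′ ⊆ X
      Y′⊆Y : Y′ ⊆ Y
      disjoint : X′ ∩ Y′ ≡ ∅
      same-union : X′ ∪ Y′ ≡ X ∪ Y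
      conn-X′ : conn G X′ < k
      conn-Y′ : conn G Y′ < k

  module _ {k : ℕ} where

    Uncrossing-swap : ∀ {X Y} → Uncrossing k X Y → Uncrossing k Y X
    Uncrossing-swap u = record
      { X′ = Y′ ; Y′ = X′ ; X′⊆X = Y′⊆Y ; Y′⊆Y = X′⊆X
      ; disjoint = trans (∩-comm Y′ X′) disjoint
      ; same-union = trans (∪-comm Y′ X′) (trans same-union (∪-comm _ _))
      ; conn-X′ = conn-Y′ ; conn-Y′ = conn-X′ }
      where open Uncrossing u

    Uncrossing-shrinkˡ : ∀ {X Y} → Uncrossing k (X ─ Y) Y → Uncrossing k X Y
    Uncrossing-shrinkˡ {X} {Y} u = record
      { X′ = X′ ; Y′ = Y′ ; X′⊆X = ⊆-trans X′⊆X (p─q⊆p X Y) ; Y′⊆Y = Y′⊆Y ; disjoint = disjoint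
      ; same-union = trans same-union ([p─q]∪q≡p∪q X Y)
      ; conn-X′ = conn-X′ ; conn-Y′ = conn-Y′ }
      where open Uncrossing u

    Uncrossing-shrinkʳ : ∀ {X Y} → Uncrossing k X (Y ─ X) → Uncrossing k X Y
    Uncrossing-shrinkʳ u = Uncrossing-swap (Uncrossing-shrinkˡ (Uncrossing-swap u))

    uncross-acc : ∀ X Y → Acc _<_ (∣ X ∣ + ∣ Y ∣) → conn G X < k → conn G Y < k → Uncrossing k X Y
    uncross-acc X Y (acc rs) cX cY with nonempty? (X ∩ Y)
    ... | no X∩Y-empty = record
      { X′ = X ; Y′ = Y ; X′⊆X = id ; Y′⊆Y = id ; disjoint = Empty-unique X∩Y-empty
      ; same-union = refl ; conn-X′ = cX ; conn-Y′ = cY }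
    ... | yes X∩Y-nonempty with conn G (X ─ Y) ≤? conn G X
    ...   | yes shrinks = Uncrossing-shrinkˡ (uncross-acc (X ─ Y) Y
            (rs (+-monoˡ-< ∣ Y ∣ (p∩q≢∅⇒∣p─q∣<∣p∣ X Y X∩Y-nonempty)))
            (≤-<-trans shrinks cX) cY)
    ...   | no grows = Uncrossing-shrinkʳ (uncross-acc X (Y ─ X)
            (rs (+-monoʳ-< ∣ X ∣ (p∩q≢∅⇒∣p─q∣<∣p∣ Y X Y∩X-nonempty)))
            cX (<-trans (conn-─-trade X Y (≰⇒> grows)) cY))
      where
      Y∩X-nonempty : Nonempty (Y ∩ X)
      Y∩X-nonempty = subst Nonempty (∩-comm X Y) X∩Y-nonempty

    uncross : ∀ {X Y} → conn G X < k → conn G Y < k → Uncrossing k X Y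
    uncross {X} {Y} = uncross-acc X Y (<-wellFounded _)

  conn-∩-⊇ : ∀ {X S} → S ⊆ X → conn G (X ∩ S) ≡ conn G S
  conn-∩-⊇ {X} {S} S⊆X = cong (conn G) (trans (∩-comm X S) (p⊆q⇒p∩q≡p S⊆X))

  conn-∩-disjoint : ∀ {X S} → X ∩ S ≡ ∅ → conn G (X ∩ S) ≡ 0
  conn-∩-disjoint X∩S≡∅ = trans (cong (conn G) X∩S≡∅) conn-∅

  restrict-cover : ∀ {X Y Z} (S : Subset nE) →
    X ∪ (Y ∪ Z) ≡ full → (X ∩ S) ∪ ((Y ∩ S) ∪ (Z ∩ S)) ≡ S
  restrict-cover {X} {Y} {Z} S cover = begin
    (X ∩ S) ∪ ((Y ∩ S) ∪ (Z ∩ S))   ≡⟨ cong ((X ∩ S) ∪_) (∩-distribʳ-∪ S Y Z) ⟨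
    (X ∩ S) ∪ ((Y ∪ Z) ∩ S)         ≡⟨ ∩-distribʳ-∪ S X (Y ∪ Z) ⟨
    (X ∪ (Y ∪ Z)) ∩ S               ≡⟨ cong (_∩ S) cover ⟩
    full ∩ S                        ≡⟨ ∩-identityˡ S ⟩
    S                               ∎
    where open ≡-Reasoning

  tri-well-linked⇒split : ∀ {S} → TriWellLinked G S → 0 < conn G S → ∀ X →
    conn G S ≤ conn G (X ∩ S) ⊎ conn G S ≤ conn G (∁ X ∩ S)
  tri-well-linked⇒split {S} twl 0<connS X
    with twl (X ∩ S) (∁ X ∩ S) (∅ ∩ S)
           (disjoint-mono (p∩q⊆p X S) (p∩q⊆p (∁ X) S) (∩-inverseʳ X))
           (disjoint-mono (p∩q⊆p X S) (p∩q⊆p ∅ S) (∩-zeroʳ X))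
           (disjoint-mono (p∩q⊆p (∁ X) S) (p∩q⊆p ∅ S) (∩-zeroʳ (∁ X)))
           (restrict-cover S (trans (cong (X ∪_) (∪-identityʳ (∁ X))) (∪-inverseʳ X)))
  ... | inj₁ large = inj₁ large
  ... | inj₂ (inj₁ large) = inj₂ large
  ... | inj₂ (inj₂ large) = ⊥-elim (<⇒≱ 0<connS (subst (conn G S ≤_) conn-∅∩S large))
    where
    conn-∅∩S : conn G (∅ ∩ S) ≡ 0
    conn-∅∩S = trans (cong (conn G) (∩-zeroˡ S)) conn-∅

  tri-well-linked⇒¬small-cover : ∀ {S} → TriWellLinked G S → ∀ {X Y Z} → X ∪ (Y ∪ Z) ≡ S →
    conn G X < conn G S → conn G Y < conn G S → conn G Z < conn G S → ⊥
  tri-well-linked⇒¬small-cover {S} twl {X} {Y} {Z} cover cX cY cZ =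
    refute (twl X₂ Y₂ Z₂ X₂∩Y₂≡∅ X₂∩Z₂≡∅ (Uncrossing.disjoint u₃) union)
    where
    u₁ = uncross cX cY
    open Uncrossing u₁ using () renaming (X′ to X₁; Y′ to Y₁)
    u₂ = uncross (Uncrossing.conn-X′ u₁) cZ
    open Uncrossing u₂ using () renaming (X′ to X₂; Y′ to Z₁)
    u₃ = uncross (Uncrossing.conn-Y′ u₁) (Uncrossing.conn-Y′ u₂)
    open Uncrossing u₃ using () renaming (X′ to Y₂; Y′ to Z₂)

    X₂∩Y₂≡∅ : X₂ ∩ Y₂ ≡ ∅
    X₂∩Y₂≡∅ = disjoint-mono (Uncrossing.X′⊆X u₂) (Uncrossing.X′⊆X u₃) (Uncrossing.disjoint u₁)

    X₂∩Z₂≡∅ : X₂ ∩ Z₂ ≡ ∅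
    X₂∩Z₂≡∅ = disjoint-mono id (Uncrossing.Y′⊆Y u₃) (Uncrossing.disjoint u₂)

    union : X₂ ∪ (Y₂ ∪ Z₂) ≡ S
    union = begin
      X₂ ∪ (Y₂ ∪ Z₂)    ≡⟨ cong (X₂ ∪_) (Uncrossing.same-union u₃) ⟩
      X₂ ∪ (Y₁ ∪ Z₁)    ≡⟨ x∙yz≈y∙xz X₂ Y₁ Z₁ ⟩
      Y₁ ∪ (X₂ ∪ Z₁)    ≡⟨ cong (Y₁ ∪_) (Uncrossing.same-union u₂) ⟩
      Y₁ ∪ (X₁ ∪ Z)     ≡⟨ x∙yz≈y∙xz Y₁ X₁ Z ⟩
      X₁ ∪ (Y₁ ∪ Z)     ≡⟨ ∪-assoc X₁ Y₁ Z ⟨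
      (X₁ ∪ Y₁) ∪ Z     ≡⟨ cong (_∪ Z) (Uncrossing.same-union u₁) ⟩
      (X ∪ Y) ∪ Z       ≡⟨ ∪-assoc X Y Z ⟩
      X ∪ (Y ∪ Z)       ≡⟨ cover ⟩
      S                 ∎
      where open ≡-Reasoning

    refute : conn G X₂ ≥ conn G S ⊎ conn G Y₂ ≥ conn G S ⊎ conn G Z₂ ≥ conn G S → ⊥
    refute (inj₁ large) = <⇒≱ (Uncrossing.conn-X′ u₂) large
    refute (inj₂ (inj₁ large)) = <⇒≱ (Uncrossing.conn-X′ u₃) large
    refute (inj₂ (inj₂ large)) = <⇒≱ (Uncrossing.conn-Y′ u₃) large

  module _ (A : Subset nE) where

    InducedTangle : Subset nE → Set
    InducedTangle X = conn G X < conn G A × conn G (X ∩ A) < conn G A × conn G (X ∩ ∁ A) < conn G A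

    InducedTangle-orient : TriWellLinked G A → TriWellLinked G (∁ A) →
      ∀ X → conn G X < conn G A → InducedTangle X ⊎ InducedTangle (∁ X)
    InducedTangle-orient twA tw∁A X cX = orient
      (tri-well-linked⇒split twA 0<k X)
      (Sum.map (subst (_≤ conn G (X ∩ ∁ A)) (conn-∁ A)) (subst (_≤ conn G (∁ X ∩ ∁ A)) (conn-∁ A))
        (tri-well-linked⇒split tw∁A (subst (0 <_) (sym (conn-∁ A)) 0<k) X))
      where
      k = conn G A

      0<k : 0 < k
      0<k = ≤-<-trans z≤n cX

      submodular : conn G (X ∩ A) + conn G (∁ X ∩ ∁ A) ≤ conn G X + k
      submodular = conn-∩-∁∩ X A

      posimodular : conn G (X ∩ ∁ A) + conn G (∁ X ∩ A) ≤ conn G X + k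
      posimodular = conn-posimodular X A

      orient : k ≤ conn G (X ∩ A) ⊎ k ≤ conn G (∁ X ∩ A) →
               k ≤ conn G (X ∩ ∁ A) ⊎ k ≤ conn G (∁ X ∩ ∁ A) →
               InducedTangle X ⊎ InducedTangle (∁ X)
      orient (inj₁ k≤a₁) (inj₁ k≤b₁) = inj₂ (subst (_< k) (sym (conn-∁ X)) cX ,
        large⇒smallʳ cX posimodular k≤b₁ , large⇒smallʳ cX submodular k≤a₁)
      orient (inj₂ k≤a₂) (inj₂ k≤b₂) = inj₁ (cX ,
        large⇒smallˡ cX submodular k≤b₂ , large⇒smallˡ cX posimodular k≤a₂)
      orient (inj₁ k≤a₁) (inj₂ k≤b₂) = ⊥-elim (<⇒≱ (large⇒smallʳ cX submodular k≤a₁) k≤b₂)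
      orient (inj₂ k≤a₂) (inj₁ k≤b₁) = ⊥-elim (<⇒≱ (large⇒smallʳ cX posimodular k≤b₁) k≤a₂)

    InducedTangle-¬cover : TriWellLinked G A → ∀ {X Y Z} →
      InducedTangle X → InducedTangle Y → InducedTangle Z → X ∪ (Y ∪ Z) ≢ full
    InducedTangle-¬cover twA (_ , cX , _) (_ , cY , _) (_ , cZ , _) cover =
      tri-well-linked⇒¬small-cover twA (restrict-cover A cover) cX cY cZ

    InducedTangle-¬co-singleton : ∀ e → ¬ InducedTangle (∁ ⁅ e ⁆)
    InducedTangle-¬co-singleton e (_ , cA , c∁A) with e ∈? A
    ... | yes e∈A =
      n≮n _ (subst (_< conn G A) (trans (conn-∩-⊇ (x∉p⇒p⊆∁⁅x⁆ (x∈p⇒x∉∁p e∈A))) (conn-∁ A)) c∁A)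
    ... | no e∉A = n≮n _ (subst (_< conn G A) (conn-∩-⊇ (x∉p⇒p⊆∁⁅x⁆ e∉A)) cA)

    InducedTangle-⊇sides : ∀ B → conn G B < conn G A → B ⊆ A ⊎ B ⊆ ∁ A → InducedTangle B
    InducedTangle-⊇sides B cB (inj₁ B⊆A) =
      cB , subst (_< _) (sym (cong (conn G) (p⊆q⇒p∩q≡p B⊆A))) cB ,
      subst (_< _) (sym (conn-∩-disjoint (disjoint-mono B⊆A id (∩-inverseʳ A)))) (≤-<-trans z≤n cB)
    InducedTangle-⊇sides B cB (inj₂ B⊆∁A) =
      cB ,
      subst (_< _) (sym (conn-∩-disjoint (disjoint-mono B⊆∁A id (∩-inverseˡ A)))) (≤-<-trans z≤n cB) ,
      subst (_< _) (sym (cong (conn G) (p⊆q⇒p∩q≡p B⊆∁A))) cB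

lemma6p17 : (G : Hypergraph) (A : Subset (Hypergraph.nE G)) →
    TriWellLinked G A → TriWellLinked G (∁ A) →
    Σ (Subset (Hypergraph.nE G) → Set) λ 𝒯 →
    IsTangle G (conn G A) 𝒯 ×
    (∀ B → conn G B < conn G A → (B ⊆ A ⊎ B ⊆ ∁ A) → 𝒯 B)
lemma6p17 G A twA tw∁A =
  InducedTangle G A ,
  ( (λ _ → proj₁)
  , InducedTangle-orient G A twA tw∁A
  , (λ _ _ _ → InducedTangle-¬cover G A twA)
  , InducedTangle-¬co-singleton G A )
  , InducedTangle-⊇sides G A
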